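{- Let $S$ be a Steiner triple system of order $n>7$ and let $\Gamma_S$ be its block graph. If $n\equiv 1\pmod 4$ then $m(1,\Gamma_S)\le 4$, and if $n\equiv 3\pmod 4$ then $m(1,\Gamma_S)\le 5$.
   Context: A Steiner triple system (STS) of order $n$ is a collection $S$ of $3$-subsets (blocks) of $\{1,\dots,n\}$ such that every $2$-subset lies in exactly one block. The block graph $\Gamma_S$ has the blocks of $S$ as vertices, two distinct blocks being adjacent iff they intersect; it is strongly regular with eigenvalues $\theta_0>\theta_1>\theta_2$, where $\theta_1(\Gamma_S)=\frac{n-1}{2}-4$ and $\theta_2(\Gamma_S)=-3$. A $\theta$-eigenvector is a nonzero vector $v$ with $Av=\theta v$ for the adjacency matrix $A$. A vector is nowhere-zero integer (NZI) if all entries are nonzero integers; $\|v\|_\infty=\max_x|v_x|$. For a graph $\Gamma$, $m(i,\Gamma)=\min\{\|u\|_\infty+1: u \text{ an NZI } \theta_i(\Gamma)\text{ -eigenvector of }\Gamma\}$. -}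

module Defs where

open import Data.Nat as ℕ using (ℕ; _>_; _%_; _/_; _∸_)
open import Data.Integer as ℤ using (ℤ; +_; _-_; _*_)
open import Data.Fin using (Fin; _≟_)
open import Data.Fin.Subset as FS using (Subset; _∈_)
open import Data.Fin.Subset.Properties using (_∈?_)
open import Data.Fin.Properties using (any?)
open import Data.Product using (Σ; ∃; _×_; _,_)
open import Data.List using (List; foldr; map)
open import Data.List.Base using (allFin)
open import Relation.Nullary using (¬_; Dec; does)
open import Relation.Nullary.Decidable using (_×-dec_; ¬?)
open import Relation.Binary.PropositionalEquality using (_≡_; _≢_)
open import Data.Bool using (if_then_else_)

-- A Steiner triple system of order n with b blocks: the blocks are
-- indexed by Fin b (B : Fin b → Subset n), each block is a 3-subset of
-- the point set Fin n, and every 2-subset {x , y} (x ≢ y) lies in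
-- exactly one block.  (Uniqueness forces distinct indices to give
-- distinct blocks, so the indexing is a faithful enumeration of the set S.)
record IsSTS (n b : ℕ) (B : Fin b → Subset n) : Set where
  field
    block-size : ∀ i → FS.∣ B i ∣ ≡ 3
    pair-covered : ∀ (x y : Fin n) → x ≢ y → ∃ λ i → x ∈ B i × y ∈ B i
    pair-unique : ∀ (x y : Fin n) → x ≢ y → ∀ i j →
      x ∈ B i → y ∈ B i → x ∈ B j → y ∈ B j → i ≡ j

Adjacent : ∀ {n b} → (Fin b → Subset n) → Fin b → Fin b → Set
Adjacent {n} B i j = (i ≢ j) × (∃ λ (x : Fin n) → x ∈ B i × x ∈ B j)

adjacent? : ∀ {n b} (B : Fin b → Subset n) i j → Dec (Adjacent B i j)
adjacent? B i j = ¬? (i ≟ j) ×-dec any? (λ x → (x ∈? B i) ×-dec (x ∈? B j))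

sumℤ : List ℤ → ℤ
sumℤ = foldr ℤ._+_ (+ 0)

blockGraphMul : ∀ {n b} → (Fin b → Subset n) → (Fin b → ℤ) → Fin b → ℤ
blockGraphMul {b = b} B u i =
  sumℤ (map (λ j → if does (adjacent? B i j) then u j else + 0) (allFin b))

IsEigenvector : ∀ {n b} → (Fin b → Subset n) → ℤ → (Fin b → ℤ) → Set
IsEigenvector B θ v = (∃ λ i → v i ≢ + 0) × (∀ i → blockGraphMul B v i ≡ θ * v i)

NowhereZero : ∀ {b} → (Fin b → ℤ) → Set
NowhereZero v = ∀ i → v i ≢ + 0

SupNormLe : ∀ {b} → (Fin b → ℤ) → ℕ → Set
SupNormLe v k = ∀ i → ℤ.∣ v i ∣ ℕ.≤ k

theta1 : ℕ → ℤ
theta1 n = + ((n ∸ 1) / 2) - + 4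

m1Le : ∀ {n b} → (Fin b → Subset n) → ℕ → Set
m1Le {n} B k = ∃ λ u → IsEigenvector B (theta1 n) u × NowhereZero u ×
  ((∃ λ (s : ℕ) → SupNormLe u s × s ℕ.+ 1 ℕ.≤ k))

-- Let N be the block–point incidence matrix and ρ = (n − 1)/2 the number of blocks
-- through a point.  The Steiner property gives Nᵀ N = (ρ − 1) I + J on points and
-- N Nᵀ = A + 3 I on blocks, hence A N w = (ρ − 4) N w + 3 (Σ w) 𝟏: the block sums
-- N w of a zero-sum weighting w of the points form a θ₁-eigenvector.  Fix a point p,
-- give every other point weight ±1 and p weight c.  A block missing p then sums to
-- ±1 or ±3, and a block through p to c plus its two other weights.  If ρ is even take
-- c = 0 and let half of the blocks through p carry +1,+1 and the other half −1,−1
-- (block sums ±2).  In general take c = 4, let two blocks through p carry −1,−1 and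
-- every other one +1,−1 (block sums 2 and 4).

module Submission where

open import Defs
open import Data.Bool using (Bool; true; false; if_then_else_)
open import Data.Empty using (⊥-elim)
open import Data.Fin using (Fin; zero; suc; _≟_)
open import Data.Fin.Properties using (suc-injective)
open import Data.Fin.Subset using (Subset; _∈_; _∉_; ∣_∣; inside; outside; ∁; ⊥)
open import Data.Fin.Subset.Properties
  using (_∈?_; nonempty?; Empty-unique; x∈∁p⇒x∉p; ∣∁p∣≡n∸∣p∣; ∣⊥∣≡0)
open import Data.Integer as ℤ using (ℤ; +_; _+_; _*_; _-_; -_)
import Data.Integer.Properties as ℤP
open import Data.Integer.Tactic.RingSolver using (solve-∀)
open import Data.List using (map; tabulate)
open import Data.List.Base using (allFin)
open import Data.List.Properties using (map-tabulate)
open import Data.Nat as ℕ using (ℕ; zero; suc; _>_; _%_; _∸_; _/_)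
import Data.Nat.DivMod as ℕ
import Data.Nat.Properties as ℕP
open import Data.Product using (∃; ∃₂; _×_; _,_; proj₁; proj₂)
open import Data.Sum using (_⊎_; inj₁; inj₂)
open import Data.Vec using ([]; _∷_; here; there)
open import Function using (_∘_)
open import Relation.Nullary using (¬_; Dec; yes; no; does)
open import Relation.Nullary.Decidable using (¬?)
open import Relation.Binary.PropositionalEquality
open import Algebra.Properties.Semiring.Sum ℤP.+-*-semiring
  using (sum; sum-syntax; sum-cong-≗; ∑-distrib-+; ∑-comm; *-distribˡ-sum; *-distribʳ-sum; sum-replicate-zero)
open import Algebra.Properties.AbelianGroup ℤP.+-0-abelianGroup using (∙-cancelˡ)
open ≡-Reasoning

𝟙 : Bool → ℤ
𝟙 true = + 1
𝟙 false = + 0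

⟦_⟧ : ∀ {ℓ} {P : Set ℓ} → Dec P → ℤ
⟦ d ⟧ = 𝟙 (does d)

⟦⟧-yes : ∀ {ℓ} {P : Set ℓ} (d : Dec P) → P → ⟦ d ⟧ ≡ + 1
⟦⟧-yes (yes _) _ = refl
⟦⟧-yes (no ¬p) p = ⊥-elim (¬p p)

⟦⟧-no : ∀ {ℓ} {P : Set ℓ} (d : Dec P) → ¬ P → ⟦ d ⟧ ≡ + 0
⟦⟧-no (yes p) ¬p = ⊥-elim (¬p p)
⟦⟧-no (no _) _ = refl

⟦⟧+⟦¬⟧ : ∀ {ℓ} {P : Set ℓ} (d : Dec P) → ⟦ d ⟧ + ⟦ ¬? d ⟧ ≡ + 1
⟦⟧+⟦¬⟧ (yes _) = refl
⟦⟧+⟦¬⟧ (no _) = refl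

𝟙-idem : ∀ c → 𝟙 c * 𝟙 c ≡ 𝟙 c
𝟙-idem true = refl
𝟙-idem false = refl

if-then-0 : ∀ c v → (if c then v else + 0) ≡ 𝟙 c * v
if-then-0 true v = sym (ℤP.*-identityˡ v)
if-then-0 false v = refl

sumℤ-allFin : ∀ k (f : Fin k → ℤ) → sumℤ (map f (allFin k)) ≡ ∑[ i < k ] f i
sumℤ-allFin k f = trans (cong sumℤ (map-tabulate (λ i → i) f)) (sumℤ-tabulate k f)
  where
  sumℤ-tabulate : ∀ k (f : Fin k → ℤ) → sumℤ (tabulate f) ≡ ∑[ i < k ] f i
  sumℤ-tabulate zero f = refl
  sumℤ-tabulate (suc k) f = cong (λ s → f zero + s) (sumℤ-tabulate k (f ∘ suc))

∑-one : ∀ k → ∑[ i < k ] (+ 1) ≡ + k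
∑-one zero = refl
∑-one (suc k) = cong (λ s → + 1 + s) (∑-one k)

∑-single : ∀ {k} (f : Fin k → ℤ) i → (∀ j → j ≢ i → f j ≡ + 0) → ∑[ j < k ] f j ≡ f i
∑-single {suc k} f zero off =
  trans (cong (λ s → f zero + s) (trans (sum-cong-≗ (λ j → off (suc j) λ ())) (sum-replicate-zero k)))
        (ℤP.+-identityʳ (f zero))
∑-single {suc k} f (suc i) off =
  trans (cong (_+ ∑[ j < k ] f (suc j)) (off zero λ ()))
        (trans (ℤP.+-identityˡ _) (∑-single (f ∘ suc) i (λ j j≢i → off (suc j) (j≢i ∘ suc-injective))))

∑-δ : ∀ {k} i (f : Fin k → ℤ) → ∑[ j < k ] (⟦ i ≟ j ⟧ * f j) ≡ f i
∑-δ i f = trans (∑-single _ i off) (trans (cong (_* f i) (⟦⟧-yes (i ≟ i) refl)) (ℤP.*-identityˡ (f i)))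
  where
  off : ∀ j → j ≢ i → ⟦ i ≟ j ⟧ * f j ≡ + 0
  off j j≢i = cong (_* f j) (⟦⟧-no (i ≟ j) (j≢i ∘ sym))

∑-split : ∀ {k} i (f : Fin k → ℤ) → ∑[ j < k ] f j ≡ f i + ∑[ j < k ] (⟦ ¬? (i ≟ j) ⟧ * f j)
∑-split {k} i f = begin
  ∑[ j < k ] f j
    ≡⟨ sum-cong-≗ (λ j → sym (split j)) ⟩
  ∑[ j < k ] (⟦ i ≟ j ⟧ * f j + ⟦ ¬? (i ≟ j) ⟧ * f j)
    ≡⟨ ∑-distrib-+ (λ j → ⟦ i ≟ j ⟧ * f j) (λ j → ⟦ ¬? (i ≟ j) ⟧ * f j) ⟩
  ∑[ j < k ] (⟦ i ≟ j ⟧ * f j) + ∑[ j < k ] (⟦ ¬? (i ≟ j) ⟧ * f j)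
    ≡⟨ cong (_+ ∑[ j < k ] (⟦ ¬? (i ≟ j) ⟧ * f j)) (∑-δ i f) ⟩
  f i + ∑[ j < k ] (⟦ ¬? (i ≟ j) ⟧ * f j) ∎
  where
  split : ∀ j → ⟦ i ≟ j ⟧ * f j + ⟦ ¬? (i ≟ j) ⟧ * f j ≡ f j
  split j = trans (sym (ℤP.*-distribʳ-+ (f j) ⟦ i ≟ j ⟧ ⟦ ¬? (i ≟ j) ⟧))
                  (trans (cong (_* f j) (⟦⟧+⟦¬⟧ (i ≟ j))) (ℤP.*-identityˡ (f j)))

∑-nonzero : ∀ {k} (f : Fin k → ℤ) → ∑[ i < k ] f i ≢ + 0 → ∃ λ i → f i ≢ + 0
∑-nonzero {zero} f ∑≢0 = ⊥-elim (∑≢0 refl)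
∑-nonzero {suc k} f ∑≢0 with f zero ℤP.≟ + 0
... | no f₀≢0 = zero , f₀≢0
... | yes f₀≡0 =
  let i , fi≢0 = ∑-nonzero (f ∘ suc) (λ rest≡0 → ∑≢0 (cong₂ _+_ f₀≡0 rest≡0)) in suc i , fi≢0

∑-⟦⟧-ℕ : ∀ {ℓ k} {P : Fin k → Set ℓ} (d : ∀ i → Dec (P i)) → ∃ λ c → ∑[ i < k ] ⟦ d i ⟧ ≡ + c
∑-⟦⟧-ℕ {k = zero} d = 0 , refl
∑-⟦⟧-ℕ {k = suc k} d with ∑-⟦⟧-ℕ (d ∘ suc) | d zero
... | c , ∑≡c | yes _ = suc c , cong (λ s → + 1 + s) ∑≡c
... | c , ∑≡c | no _ = c , trans (ℤP.+-identityˡ _) ∑≡c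

∑-∈ : ∀ {k} (p : Subset k) → ∑[ x < k ] ⟦ x ∈? p ⟧ ≡ + ∣ p ∣
∑-∈ [] = refl
∑-∈ (inside ∷ p) = cong (λ s → + 1 + s) (∑-∈ p)
∑-∈ (outside ∷ p) = trans (ℤP.+-identityˡ _) (∑-∈ p)

∃-selection : ∀ {k} (g : Fin k → Bool) t u → ∑[ i < k ] 𝟙 (g i) ≡ + (t ℕ.+ u) →
  ∃ λ (sel : Fin k → Bool) → ∑[ i < k ] (𝟙 (g i) * 𝟙 (sel i)) ≡ + t
∃-selection {k} g zero u _ =
  (λ _ → false) , trans (sum-cong-≗ {k} (λ i → ℤP.*-zeroʳ (𝟙 (g i)))) (sum-replicate-zero k)
∃-selection {zero} g (suc t) u ()
∃-selection {suc k} g (suc t) u ∑≡ with g zero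
... | false =
  let sel , ∑sel≡ = ∃-selection (g ∘ suc) (suc t) u (trans (sym (ℤP.+-identityˡ _)) ∑≡)
  in (λ { zero → false ; (suc i) → sel i }) , trans (ℤP.+-identityˡ _) ∑sel≡
... | true =
  let sel , ∑sel≡ = ∃-selection (g ∘ suc) t u (∙-cancelˡ (+ 1) _ _ ∑≡)
  in (λ { zero → true ; (suc i) → sel i }) , cong (λ s → + 1 + s) ∑sel≡

Sign : ℤ → Set
Sign x = x ≡ + 1 ⊎ x ≡ - + 1

∑-signs : ∀ {k} (p : Subset k) (v : Fin k → ℤ) → (∀ x → x ∈ p → Sign (v x)) →
  ∃₂ λ a c → a ℕ.+ c ≡ ∣ p ∣ × ∑[ x < k ] (⟦ x ∈? p ⟧ * v x) ≡ + a - + c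
∑-signs [] v _ = 0 , 0 , refl , refl
∑-signs (outside ∷ p) v v± with ∑-signs p (v ∘ suc) (λ x x∈p → v± (suc x) (there x∈p))
... | a , c , a+c , ∑≡ = a , c , a+c , trans (ℤP.+-identityˡ _) ∑≡
∑-signs (inside ∷ p) v v± with ∑-signs p (v ∘ suc) (λ x x∈p → v± (suc x) (there x∈p)) | v± zero here
... | a , c , a+c , ∑≡ | inj₁ v₀≡1 =
  suc a , c , cong suc a+c ,
  trans (cong₂ _+_ (trans (ℤP.*-identityˡ _) v₀≡1) ∑≡) (plus (+ a) (+ c))
  where
  plus : ∀ x y → + 1 + (x - y) ≡ (+ 1 + x) - y
  plus = solve-∀
... | a , c , a+c , ∑≡ | inj₂ v₀≡-1 =
  a , suc c , trans (ℕP.+-suc a c) (cong suc a+c) ,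
  trans (cong₂ _+_ (trans (ℤP.*-identityˡ _) v₀≡-1) ∑≡) (minus (+ a) (+ c))
  where
  minus : ∀ x y → - + 1 + (x - y) ≡ x - (+ 1 + y)
  minus = solve-∀

NonzeroAtMost : ℕ → ℤ → Set
NonzeroAtMost s x = x ≢ + 0 × ℤ.∣ x ∣ ℕ.≤ s

sum-of-three-signs : ∀ a c → a ℕ.+ c ≡ 3 → NonzeroAtMost 3 (+ a - + c)
sum-of-three-signs 0 3 refl = (λ ()) , ℕP.≤-refl
sum-of-three-signs 1 2 refl = (λ ()) , ℕ.s≤s ℕ.z≤n
sum-of-three-signs 2 1 refl = (λ ()) , ℕ.s≤s ℕ.z≤n
sum-of-three-signs 3 0 refl = (λ ()) , ℕP.≤-refl

m1Le-intro : ∀ {n b} (B : Fin b → Subset n) (u : Fin b → ℤ) s → Fin b →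
  (∀ i → blockGraphMul B u i ≡ theta1 n * u i) → (∀ i → NonzeroAtMost s (u i)) → m1Le B (suc s)
m1Le-intro B u s i₀ eigen entry =
  u , ((i₀ , proj₁ (entry i₀)) , eigen) , proj₁ ∘ entry ,
  s , proj₂ ∘ entry , ℕP.≤-reflexive (ℕP.+-comm s 1)

module BlockGraph {n b : ℕ} {B : Fin b → Subset n} (S : IsSTS n b B) where
  open IsSTS S

  inc : Fin b → Fin n → ℤ
  inc j x = ⟦ x ∈? B j ⟧

  ∑-inc-block : ∀ j → ∑[ x < n ] inc j x ≡ + 3
  ∑-inc-block j = trans (∑-∈ (B j)) (cong +_ (block-size j))

  inc-∈ : ∀ {j x} → x ∈ B j → inc j x ≡ + 1
  inc-∈ {j} {x} = ⟦⟧-yes (x ∈? B j)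

  ∑-inc-pair : ∀ {x y} → x ≢ y → ∀ {j₀} → x ∈ B j₀ → y ∈ B j₀ → (g : Fin b → ℤ) →
    ∑[ j < b ] (inc j x * (inc j y * g j)) ≡ g j₀
  ∑-inc-pair {x} {y} x≢y {j₀} x∈j₀ y∈j₀ g = begin
    ∑[ j < b ] (inc j x * (inc j y * g j))  ≡⟨ ∑-single _ j₀ off ⟩
    inc j₀ x * (inc j₀ y * g j₀)            ≡⟨ cong₂ (λ u v → u * (v * g j₀)) (inc-∈ x∈j₀) (inc-∈ y∈j₀) ⟩
    + 1 * (+ 1 * g j₀)                      ≡⟨ trans (ℤP.*-identityˡ _) (ℤP.*-identityˡ _) ⟩
    g j₀                                    ∎
    where
    off : ∀ j → j ≢ j₀ → inc j x * (inc j y * g j) ≡ + 0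
    off j j≢j₀ with x ∈? B j | y ∈? B j
    ... | no _     | _        = refl
    ... | yes _    | no _     = refl
    ... | yes x∈j  | yes y∈j  = ⊥-elim (j≢j₀ (pair-unique x y x≢y j j₀ x∈j y∈j x∈j₀ y∈j₀))

  ∑-inc-distinct : ∀ {x y} → x ≢ y → ∑[ j < b ] (inc j x * inc j y) ≡ + 1
  ∑-inc-distinct {x} {y} x≢y =
    let j₀ , x∈j₀ , y∈j₀ = pair-covered x y x≢y in
    trans (sum-cong-≗ (λ j → cong (inc j x *_) (sym (ℤP.*-identityʳ (inc j y)))))
          (∑-inc-pair x≢y x∈j₀ y∈j₀ (λ _ → + 1))

  replication : Fin n → ℤ
  replication x = ∑[ j < b ] inc j x

  ∑-inc-inc : ∀ x y → ∑[ j < b ] (inc j x * inc j y) ≡ ⟦ x ≟ y ⟧ * (replication x - + 1) + + 1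
  ∑-inc-inc x y with x ≟ y
  ... | yes refl = trans (sum-cong-≗ (λ j → 𝟙-idem (does (x ∈? B j)))) (sym (one-more (replication x)))
    where
    one-more : ∀ r → + 1 * (r - + 1) + + 1 ≡ r
    one-more = solve-∀
  ... | no x≢y = ∑-inc-distinct x≢y

  -- Count the pairs (j , y) with x , y ∈ B j in two ways.
  replication-equation : ∀ x → replication x * + 3 ≡ replication x - + 1 + + n
  replication-equation x = begin
    replication x * + 3
      ≡⟨ *-distribʳ-sum (+ 3) (λ j → inc j x) ⟩
    ∑[ j < b ] (inc j x * + 3)
      ≡⟨ sum-cong-≗ (λ j → cong (inc j x *_) (sym (∑-inc-block j))) ⟩
    ∑[ j < b ] (inc j x * ∑[ y < n ] inc j y)
      ≡⟨ sum-cong-≗ (λ j → *-distribˡ-sum (inc j x) (inc j)) ⟩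
    ∑[ j < b ] ∑[ y < n ] (inc j x * inc j y)
      ≡⟨ ∑-comm (λ j y → inc j x * inc j y) ⟩
    ∑[ y < n ] ∑[ j < b ] (inc j x * inc j y)
      ≡⟨ sum-cong-≗ (∑-inc-inc x) ⟩
    ∑[ y < n ] (⟦ x ≟ y ⟧ * (replication x - + 1) + + 1)
      ≡⟨ ∑-distrib-+ (λ y → ⟦ x ≟ y ⟧ * (replication x - + 1)) (λ _ → + 1) ⟩
    ∑[ y < n ] (⟦ x ≟ y ⟧ * (replication x - + 1)) + ∑[ y < n ] (+ 1)
      ≡⟨ cong₂ _+_ (∑-δ x (λ _ → replication x - + 1)) (∑-one n) ⟩
    replication x - + 1 + + n ∎

  ρ : ℕ
  ρ = (n ∸ 1) / 2

  replication≡ρ : ∀ x → replication x ≡ + ρ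
  replication≡ρ x with ∑-⟦⟧-ℕ (λ j → x ∈? B j)
  ... | r , r-def = trans r-def (cong +_ r≡ρ)
    where
    solve-linear : ∀ r m → r * + 3 ≡ r - + 1 + m → r * + 2 + + 1 ≡ m
    solve-linear r m e = begin
      r * + 2 + + 1          ≡⟨ twice r ⟩
      r * + 3 - r + + 1      ≡⟨ cong (λ z → z - r + + 1) e ⟩
      r - + 1 + m - r + + 1  ≡⟨ cancel r m ⟩
      m                      ∎
      where
      twice : ∀ r → r * + 2 + + 1 ≡ r * + 3 - r + + 1
      twice = solve-∀
      cancel : ∀ r m → r - + 1 + m - r + + 1 ≡ m
      cancel = solve-∀
    2r+1≡n : r ℕ.* 2 ℕ.+ 1 ≡ n
    2r+1≡n = ℤP.+-injective (begin
      + (r ℕ.* 2 ℕ.+ 1)  ≡⟨ ℤP.pos-+ (r ℕ.* 2) 1 ⟩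
      + (r ℕ.* 2) + + 1  ≡⟨ cong (_+ + 1) (ℤP.pos-* r 2) ⟩
      + r * + 2 + + 1    ≡⟨ solve-linear (+ r) (+ n)
                              (subst (λ z → z * + 3 ≡ z - + 1 + + n) r-def (replication-equation x)) ⟩
      + n                ∎)
    r≡ρ : r ≡ ρ
    r≡ρ = sym (begin
      (n ∸ 1) / 2                   ≡⟨ cong (λ z → (z ∸ 1) / 2) (sym 2r+1≡n) ⟩
      (r ℕ.* 2 ℕ.+ 1 ∸ 1) / 2       ≡⟨ cong (_/ 2) (ℕP.m+n∸n≡m (r ℕ.* 2) 1) ⟩
      r ℕ.* 2 / 2                   ≡⟨ ℕ.m*n/n≡m r 2 ⟩
      r                             ∎)

  ∑-inc-self : ∀ i → ∑[ y < n ] (inc i y * inc i y) ≡ + 3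
  ∑-inc-self i = trans (sum-cong-≗ (λ y → 𝟙-idem (does (y ∈? B i)))) (∑-inc-block i)

  ∑-inc-meet : ∀ {i j} → Adjacent B i j → ∑[ y < n ] (inc i y * inc j y) ≡ + 1
  ∑-inc-meet {i} {j} (i≢j , y₀ , y₀∈i , y₀∈j) =
    trans (∑-single _ y₀ off) (cong₂ _*_ (inc-∈ y₀∈i) (inc-∈ y₀∈j))
    where
    off : ∀ y → y ≢ y₀ → inc i y * inc j y ≡ + 0
    off y y≢y₀ with y ∈? B i | y ∈? B j
    ... | no _     | _        = refl
    ... | yes _    | no _     = refl
    ... | yes y∈i  | yes y∈j  = ⊥-elim (i≢j (pair-unique y₀ y (y≢y₀ ∘ sym) i j y₀∈i y∈i y₀∈j y∈j))

  ∑-inc-disjoint : ∀ {i j} → i ≢ j → ¬ Adjacent B i j → ∑[ y < n ] (inc i y * inc j y) ≡ + 0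
  ∑-inc-disjoint {i} {j} i≢j ¬adj = trans (sum-cong-≗ off) (sum-replicate-zero n)
    where
    off : ∀ y → inc i y * inc j y ≡ + 0
    off y with y ∈? B i | y ∈? B j
    ... | no _     | _        = refl
    ... | yes _    | no _     = refl
    ... | yes y∈i  | yes y∈j  = ⊥-elim (¬adj (i≢j , y , y∈i , y∈j))

  ∑-inc-nonadjacent : ∀ {i j} → ¬ Adjacent B i j → ∑[ y < n ] (inc i y * inc j y) ≡ + 3 * ⟦ i ≟ j ⟧
  ∑-inc-nonadjacent {i} {j} ¬adj with i ≟ j
  ... | yes refl = ∑-inc-self i
  ... | no i≢j   = ∑-inc-disjoint i≢j ¬adj

  adjacency+3δ : ∀ i j → ⟦ adjacent? B i j ⟧ + + 3 * ⟦ i ≟ j ⟧ ≡ ∑[ y < n ] (inc i y * inc j y)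
  adjacency+3δ i j = by-adjacency (adjacent? B i j)
    where
    by-adjacency : Dec (Adjacent B i j) → ⟦ adjacent? B i j ⟧ + + 3 * ⟦ i ≟ j ⟧ ≡ ∑[ y < n ] (inc i y * inc j y)
    by-adjacency (yes adj) =
      trans (cong₂ (λ a d → a + + 3 * d) (⟦⟧-yes (adjacent? B i j) adj) (⟦⟧-no (i ≟ j) (proj₁ adj)))
            (sym (∑-inc-meet adj))
    by-adjacency (no ¬adj) =
      trans (cong (_+ + 3 * ⟦ i ≟ j ⟧) (⟦⟧-no (adjacent? B i j) ¬adj))
            (trans (ℤP.+-identityˡ _) (sym (∑-inc-nonadjacent ¬adj)))

  ∑-inc-flags : ∀ i x →
    ∑[ y < n ] (inc i y * ∑[ j < b ] (inc j x * inc j y)) ≡ (+ ρ - + 1) * inc i x + + 3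
  ∑-inc-flags i x = begin
    ∑[ y < n ] (inc i y * ∑[ j < b ] (inc j x * inc j y))
      ≡⟨ sum-cong-≗ (λ y → cong (inc i y *_) (∑-inc-inc x y)) ⟩
    ∑[ y < n ] (inc i y * (⟦ x ≟ y ⟧ * (replication x - + 1) + + 1))
      ≡⟨ sum-cong-≗ (λ y → expand (inc i y) ⟦ x ≟ y ⟧ (replication x)) ⟩
    ∑[ y < n ] ((replication x - + 1) * (⟦ x ≟ y ⟧ * inc i y) + inc i y)
      ≡⟨ ∑-distrib-+ (λ y → (replication x - + 1) * (⟦ x ≟ y ⟧ * inc i y)) (inc i) ⟩
    ∑[ y < n ] ((replication x - + 1) * (⟦ x ≟ y ⟧ * inc i y)) + ∑[ y < n ] inc i y
      ≡⟨ cong₂ _+_ (sym (*-distribˡ-sum (replication x - + 1) (λ y → ⟦ x ≟ y ⟧ * inc i y))) (∑-inc-block i) ⟩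
    (replication x - + 1) * ∑[ y < n ] (⟦ x ≟ y ⟧ * inc i y) + + 3
      ≡⟨ cong₂ (λ r m → (r - + 1) * m + + 3) (replication≡ρ x) (∑-δ x (inc i)) ⟩
    (+ ρ - + 1) * inc i x + + 3 ∎
    where
    expand : ∀ m d r → m * (d * (r - + 1) + + 1) ≡ (r - + 1) * (d * m) + m
    expand = solve-∀

  ∑-adjacent-inc : ∀ i x → ∑[ j < b ] (⟦ adjacent? B i j ⟧ * inc j x) ≡ + 3 + (+ ρ - + 4) * inc i x
  ∑-adjacent-inc i x = cancel-3m (begin
    ∑[ j < b ] (⟦ adjacent? B i j ⟧ * inc j x) + + 3 * inc i x
      ≡⟨ cong (λ t → ∑[ j < b ] (⟦ adjacent? B i j ⟧ * inc j x) + t) spread ⟩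
    ∑[ j < b ] (⟦ adjacent? B i j ⟧ * inc j x) + ∑[ j < b ] (+ 3 * (⟦ i ≟ j ⟧ * inc j x))
      ≡⟨ sym (∑-distrib-+ (λ j → ⟦ adjacent? B i j ⟧ * inc j x) (λ j → + 3 * (⟦ i ≟ j ⟧ * inc j x))) ⟩
    ∑[ j < b ] (⟦ adjacent? B i j ⟧ * inc j x + + 3 * (⟦ i ≟ j ⟧ * inc j x))
      ≡⟨ sum-cong-≗ (λ j → trans (collect ⟦ adjacent? B i j ⟧ ⟦ i ≟ j ⟧ (inc j x))
                                 (cong (_* inc j x) (adjacency+3δ i j))) ⟩
    ∑[ j < b ] (∑[ y < n ] (inc i y * inc j y) * inc j x)
      ≡⟨ sum-cong-≗ (λ j → *-distribʳ-sum (inc j x) (λ y → inc i y * inc j y)) ⟩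
    ∑[ j < b ] ∑[ y < n ] (inc i y * inc j y * inc j x)
      ≡⟨ ∑-comm (λ j y → inc i y * inc j y * inc j x) ⟩
    ∑[ y < n ] ∑[ j < b ] (inc i y * inc j y * inc j x)
      ≡⟨ sum-cong-≗ (λ y → trans (sum-cong-≗ (λ j → reorder (inc i y) (inc j y) (inc j x)))
                                 (sym (*-distribˡ-sum (inc i y) (λ j → inc j x * inc j y)))) ⟩
    ∑[ y < n ] (inc i y * ∑[ j < b ] (inc j x * inc j y))
      ≡⟨ ∑-inc-flags i x ⟩
    (+ ρ - + 1) * inc i x + + 3 ∎)
    where
    spread : + 3 * inc i x ≡ ∑[ j < b ] (+ 3 * (⟦ i ≟ j ⟧ * inc j x))
    spread = trans (cong (+ 3 *_) (sym (∑-δ i (λ j → inc j x))))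
                   (*-distribˡ-sum (+ 3) (λ j → ⟦ i ≟ j ⟧ * inc j x))
    collect : ∀ a d m → a * m + + 3 * (d * m) ≡ (a + + 3 * d) * m
    collect = solve-∀
    reorder : ∀ u v w → u * v * w ≡ u * (w * v)
    reorder = solve-∀
    cancel-3m : ∀ {s} → s + + 3 * inc i x ≡ (+ ρ - + 1) * inc i x + + 3 → s ≡ + 3 + (+ ρ - + 4) * inc i x
    cancel-3m {s} e = trans (sym (undo s (inc i x))) (trans (cong (_- + 3 * inc i x) e) (redo (+ ρ) (inc i x)))
      where
      undo : ∀ s m → s + + 3 * m - + 3 * m ≡ s
      undo = solve-∀
      redo : ∀ r m → (r - + 1) * m + + 3 - + 3 * m ≡ + 3 + (r - + 4) * m
      redo = solve-∀

  blockSum : (Fin n → ℤ) → Fin b → ℤ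
  blockSum w j = ∑[ x < n ] (inc j x * w x)

  blockSum-eigen : ∀ w → ∑[ x < n ] w x ≡ + 0 →
    ∀ i → blockGraphMul B (blockSum w) i ≡ theta1 n * blockSum w i
  blockSum-eigen w ∑w≡0 i = begin
    blockGraphMul B (blockSum w) i
      ≡⟨ sumℤ-allFin b _ ⟩
    ∑[ j < b ] (if does (adjacent? B i j) then blockSum w j else + 0)
      ≡⟨ sum-cong-≗ (λ j → if-then-0 (does (adjacent? B i j)) (blockSum w j)) ⟩
    ∑[ j < b ] (⟦ adjacent? B i j ⟧ * blockSum w j)
      ≡⟨ sum-cong-≗ (λ j → *-distribˡ-sum ⟦ adjacent? B i j ⟧ (λ x → inc j x * w x)) ⟩
    ∑[ j < b ] ∑[ x < n ] (⟦ adjacent? B i j ⟧ * (inc j x * w x))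
      ≡⟨ ∑-comm (λ j x → ⟦ adjacent? B i j ⟧ * (inc j x * w x)) ⟩
    ∑[ x < n ] ∑[ j < b ] (⟦ adjacent? B i j ⟧ * (inc j x * w x))
      ≡⟨ sum-cong-≗ (λ x → trans (sum-cong-≗ (λ j → sym (ℤP.*-assoc ⟦ adjacent? B i j ⟧ (inc j x) (w x))))
                                 (sym (*-distribʳ-sum (w x) (λ j → ⟦ adjacent? B i j ⟧ * inc j x)))) ⟩
    ∑[ x < n ] (∑[ j < b ] (⟦ adjacent? B i j ⟧ * inc j x) * w x)
      ≡⟨ sum-cong-≗ (λ x → trans (cong (_* w x) (∑-adjacent-inc i x)) (distribute (+ ρ) (inc i x) (w x))) ⟩
    ∑[ x < n ] (+ 3 * w x + (+ ρ - + 4) * (inc i x * w x))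
      ≡⟨ ∑-distrib-+ (λ x → + 3 * w x) (λ x → (+ ρ - + 4) * (inc i x * w x)) ⟩
    ∑[ x < n ] (+ 3 * w x) + ∑[ x < n ] ((+ ρ - + 4) * (inc i x * w x))
      ≡⟨ cong₂ _+_ (sym (*-distribˡ-sum (+ 3) w)) (sym (*-distribˡ-sum (+ ρ - + 4) (λ x → inc i x * w x))) ⟩
    + 3 * ∑[ x < n ] w x + (+ ρ - + 4) * blockSum w i
      ≡⟨ cong (λ s → + 3 * s + (+ ρ - + 4) * blockSum w i) ∑w≡0 ⟩
    + 0 + (+ ρ - + 4) * blockSum w i
      ≡⟨ ℤP.+-identityˡ _ ⟩
    theta1 n * blockSum w i ∎
    where
    distribute : ∀ r m v → (+ 3 + (r - + 4) * m) * v ≡ + 3 * v + (r - + 4) * (m * v)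
    distribute = solve-∀

  module Star (p : Fin n) (c : ℤ) (h : Fin b → Fin n → ℤ) where

    -- For y ≢ p only the block through p and y survives in the sum over j, so that
    -- block never has to be chosen; h j y is the weight of y on the block j through p.
    star : Fin n → ℤ
    star y = ⟦ p ≟ y ⟧ * c + ⟦ ¬? (p ≟ y) ⟧ * ∑[ j < b ] (inc j p * (inc j y * h j y))

    arm : Fin b → ℤ
    arm j = ∑[ y < n ] (⟦ ¬? (p ≟ y) ⟧ * (inc j y * h j y))

    star-off : ∀ {y j} → p ≢ y → p ∈ B j → y ∈ B j → star y ≡ h j y
    star-off {y} {j} p≢y p∈j y∈j = begin
      ⟦ p ≟ y ⟧ * c + ⟦ ¬? (p ≟ y) ⟧ * ∑[ k < b ] (inc k p * (inc k y * h k y))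
        ≡⟨ cong₂ (λ d e → d * c + e * ∑[ k < b ] (inc k p * (inc k y * h k y)))
                 (⟦⟧-no (p ≟ y) p≢y) (⟦⟧-yes (¬? (p ≟ y)) p≢y) ⟩
      + 0 + + 1 * ∑[ k < b ] (inc k p * (inc k y * h k y))
        ≡⟨ trans (ℤP.+-identityˡ _) (ℤP.*-identityˡ _) ⟩
      ∑[ k < b ] (inc k p * (inc k y * h k y))
        ≡⟨ ∑-inc-pair p≢y p∈j y∈j (λ k → h k y) ⟩
      h j y ∎

    ∑-star : ∑[ y < n ] star y ≡ c + ∑[ j < b ] (inc j p * arm j)
    ∑-star = begin
      ∑[ y < n ] star y
        ≡⟨ ∑-distrib-+ (λ y → ⟦ p ≟ y ⟧ * c) (λ y → ⟦ ¬? (p ≟ y) ⟧ * ∑[ j < b ] (inc j p * (inc j y * h j y))) ⟩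
      ∑[ y < n ] (⟦ p ≟ y ⟧ * c) + ∑[ y < n ] (⟦ ¬? (p ≟ y) ⟧ * ∑[ j < b ] (inc j p * (inc j y * h j y)))
        ≡⟨ cong₂ _+_ (∑-δ p (λ _ → c))
                     (sum-cong-≗ (λ y → *-distribˡ-sum ⟦ ¬? (p ≟ y) ⟧ (λ j → inc j p * (inc j y * h j y)))) ⟩
      c + ∑[ y < n ] ∑[ j < b ] (⟦ ¬? (p ≟ y) ⟧ * (inc j p * (inc j y * h j y)))
        ≡⟨ cong (λ s → c + s) (∑-comm (λ y j → ⟦ ¬? (p ≟ y) ⟧ * (inc j p * (inc j y * h j y)))) ⟩
      c + ∑[ j < b ] ∑[ y < n ] (⟦ ¬? (p ≟ y) ⟧ * (inc j p * (inc j y * h j y)))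
        ≡⟨ cong (λ s → c + s) (sum-cong-≗ (λ j →
             trans (sum-cong-≗ (λ y → swap ⟦ ¬? (p ≟ y) ⟧ (inc j p) (inc j y * h j y)))
                   (sym (*-distribˡ-sum (inc j p) (λ y → ⟦ ¬? (p ≟ y) ⟧ * (inc j y * h j y)))))) ⟩
      c + ∑[ j < b ] (inc j p * arm j) ∎
      where
      swap : ∀ d m v → d * (m * v) ≡ m * (d * v)
      swap = solve-∀

    blockSum-star-through : ∀ {j} → p ∈ B j → blockSum star j ≡ c + arm j
    blockSum-star-through {j} p∈j = begin
      ∑[ y < n ] (inc j y * star y)
        ≡⟨ sum-cong-≗ split ⟩
      ∑[ y < n ] (⟦ p ≟ y ⟧ * (inc j y * c) + ⟦ ¬? (p ≟ y) ⟧ * (inc j y * h j y))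
        ≡⟨ ∑-distrib-+ (λ y → ⟦ p ≟ y ⟧ * (inc j y * c)) (λ y → ⟦ ¬? (p ≟ y) ⟧ * (inc j y * h j y)) ⟩
      ∑[ y < n ] (⟦ p ≟ y ⟧ * (inc j y * c)) + arm j
        ≡⟨ cong (_+ arm j) (trans (∑-δ p (λ y → inc j y * c)) (trans (cong (_* c) (inc-∈ p∈j)) (ℤP.*-identityˡ c))) ⟩
      c + arm j ∎
      where
      split : ∀ y → inc j y * star y ≡ ⟦ p ≟ y ⟧ * (inc j y * c) + ⟦ ¬? (p ≟ y) ⟧ * (inc j y * h j y)
      split y with p ≟ y
      ... | yes refl = centre (inc j p) c (∑[ k < b ] (inc k p * (inc k p * h k p))) (inc j p * h j p)
        where
        centre : ∀ m c s t → m * (+ 1 * c + + 0 * s) ≡ + 1 * (m * c) + + 0 * t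
        centre = solve-∀
      ... | no p≢y with y ∈? B j
      ...   | no _    = refl
      ...   | yes y∈j = trans (off-centre c (∑[ k < b ] (inc k p * (inc k y * h k y))))
                              (cong (λ t → + 0 * (+ 1 * c) + + 1 * (+ 1 * t))
                                    (∑-inc-pair p≢y p∈j y∈j (λ k → h k y)))
        where
        off-centre : ∀ c s → + 1 * (+ 0 * c + + 1 * s) ≡ + 0 * (+ 1 * c) + + 1 * (+ 1 * s)
        off-centre = solve-∀

    blockSum-star-away : ∀ {j} → p ∉ B j → (∀ k y → Sign (h k y)) → NonzeroAtMost 3 (blockSum star j)
    blockSum-star-away {j} p∉j h± with ∑-signs (B j) star star-sign
      where
      star-sign : ∀ y → y ∈ B j → Sign (star y)
      star-sign y y∈j =
        let p≢y = λ p≡y → p∉j (subst (_∈ B j) (sym p≡y) y∈j)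
            k , p∈k , y∈k = pair-covered p y p≢y
        in subst Sign (sym (star-off p≢y p∈k y∈k)) (h± k y)
    ... | a , a′ , a+a′≡∣j∣ , blockSum≡ =
      subst (NonzeroAtMost 3) (sym blockSum≡) (sum-of-three-signs a a′ (trans a+a′≡∣j∣ (block-size j)))

  inc-*-cong : ∀ {j x} {f g : ℤ} → (x ∈ B j → f ≡ g) → inc j x * f ≡ inc j x * g
  inc-*-cong {j} {x} f≡g with x ∈? B j
  ... | yes x∈j = cong (+ 1 *_) (f≡g x∈j)
  ... | no _    = refl

  ∑-others-in-block : ∀ {p j} → p ∈ B j → ∑[ y < n ] (⟦ ¬? (p ≟ y) ⟧ * inc j y) ≡ + 2
  ∑-others-in-block {p} {j} p∈j =
    ∙-cancelˡ (+ 1) others (+ 2)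
      (sym (trans (sym (∑-inc-block j)) (trans (∑-split p (inc j)) (cong (_+ others) (inc-∈ p∈j)))))
    where
    others : ℤ
    others = ∑[ y < n ] (⟦ ¬? (p ≟ y) ⟧ * inc j y)

  point-outside : 3 ℕ.< n → ∀ j → ∃ λ z → z ∉ B j
  point-outside 3<n j with nonempty? (∁ (B j))
  ... | yes (z , z∈∁j) = z , x∈∁p⇒x∉p z∈∁j
  ... | no ∁j-empty = ⊥-elim (ℕP.m>n⇒m∸n≢0 3<n (begin
    n ∸ 3           ≡⟨ cong (n ∸_) (sym (block-size j)) ⟩
    n ∸ ∣ B j ∣     ≡⟨ sym (∣∁p∣≡n∸∣p∣ (B j)) ⟩
    ∣ ∁ (B j) ∣     ≡⟨ cong ∣_∣ (Empty-unique ∁j-empty) ⟩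
    ∣ ⊥ {n = n} ∣   ≡⟨ ∣⊥∣≡0 n ⟩
    0               ∎))

  two-blocks-through : ∀ {p q} → p ≢ q → 3 ℕ.< n → ∃₂ λ J₁ J₂ → J₁ ≢ J₂ × p ∈ B J₁ × p ∈ B J₂
  two-blocks-through {p} {q} p≢q 3<n =
    let J₁ , p∈J₁ , _ = pair-covered p q p≢q
        z , z∉J₁ = point-outside 3<n J₁
        J₂ , p∈J₂ , z∈J₂ = pair-covered p z (λ p≡z → z∉J₁ (subst (_∈ B J₁) p≡z p∈J₁))
    in J₁ , J₂ , (λ J₁≡J₂ → z∉J₁ (subst (λ J → z ∈ B J) (sym J₁≡J₂) z∈J₂)) , p∈J₁ , p∈J₂

  other-point : ∀ {p j} → p ∈ B j → ∃ λ y → p ≢ y × y ∈ B j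
  other-point {p} {j} p∈j =
    let y , term≢0 = ∑-nonzero _ (λ ∑≡0 → 2≢0 (trans (sym (∑-others-in-block p∈j)) ∑≡0))
    in y , nonzero-term y term≢0
    where
    2≢0 : + 2 ≢ + 0
    2≢0 ()
    nonzero-term : ∀ y → ⟦ ¬? (p ≟ y) ⟧ * inc j y ≢ + 0 → p ≢ y × y ∈ B j
    nonzero-term y term≢0 with p ≟ y | y ∈? B j
    ... | yes _   | _       = ⊥-elim (term≢0 refl)
    ... | no _    | no _    = ⊥-elim (term≢0 refl)
    ... | no p≢y  | yes y∈j = p≢y , y∈j

  partner : Fin n → Fin b → Fin n
  partner p j with p ∈? B j
  ... | yes p∈j = proj₁ (other-point p∈j)
  ... | no _    = p

  partner-∈ : ∀ {p j} → p ∈ B j → p ≢ partner p j × partner p j ∈ B j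
  partner-∈ {p} {j} p∈j with p ∈? B j
  ... | yes p∈j′ = proj₂ (other-point p∈j′)
  ... | no p∉j   = ⊥-elim (p∉j p∈j)

  m1≤4-of-even-replication : ∀ {p q} → p ≢ q → ∀ t → ρ ≡ t ℕ.* 2 → m1Le B 4
  m1≤4-of-even-replication {p} {q} p≢q t ρ≡2t with ∃-selection (λ j → does (p ∈? B j)) t t replication≡t+t
    where
    replication≡t+t : replication p ≡ + (t ℕ.+ t)
    replication≡t+t = trans (replication≡ρ p)
      (cong +_ (trans ρ≡2t (trans (ℕP.*-comm t 2) (cong (t ℕ.+_) (ℕP.+-identityʳ t)))))
  ... | sel , ∑sel≡t =
    m1Le-intro B (blockSum star) 3 (proj₁ (pair-covered p q p≢q)) (blockSum-eigen star ∑-star≡0) entry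
    where
    sign : Fin b → ℤ
    sign j = 𝟙 (sel j) * + 2 - + 1

    open Star p (+ 0) (λ j _ → sign j)

    sign-± : ∀ j → Sign (sign j)
    sign-± j with sel j
    ... | true  = inj₁ refl
    ... | false = inj₂ refl

    arm-through : ∀ {j} → p ∈ B j → arm j ≡ + 2 * sign j
    arm-through {j} p∈j = begin
      ∑[ y < n ] (⟦ ¬? (p ≟ y) ⟧ * (inc j y * sign j))
        ≡⟨ sum-cong-≗ (λ y → sym (ℤP.*-assoc ⟦ ¬? (p ≟ y) ⟧ (inc j y) (sign j))) ⟩
      ∑[ y < n ] (⟦ ¬? (p ≟ y) ⟧ * inc j y * sign j)
        ≡⟨ sym (*-distribʳ-sum (sign j) (λ y → ⟦ ¬? (p ≟ y) ⟧ * inc j y)) ⟩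
      ∑[ y < n ] (⟦ ¬? (p ≟ y) ⟧ * inc j y) * sign j
        ≡⟨ cong (_* sign j) (∑-others-in-block p∈j) ⟩
      + 2 * sign j ∎

    ∑-star≡0 : ∑[ y < n ] star y ≡ + 0
    ∑-star≡0 = begin
      ∑[ y < n ] star y
        ≡⟨ trans ∑-star (ℤP.+-identityˡ _) ⟩
      ∑[ j < b ] (inc j p * arm j)
        ≡⟨ sum-cong-≗ (λ j → trans (inc-*-cong arm-through) (expand (inc j p) (𝟙 (sel j)))) ⟩
      ∑[ j < b ] (+ 4 * (inc j p * 𝟙 (sel j)) + - + 2 * inc j p)
        ≡⟨ ∑-distrib-+ (λ j → + 4 * (inc j p * 𝟙 (sel j))) (λ j → - + 2 * inc j p) ⟩
      ∑[ j < b ] (+ 4 * (inc j p * 𝟙 (sel j))) + ∑[ j < b ] (- + 2 * inc j p)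
        ≡⟨ cong₂ _+_ (sym (*-distribˡ-sum (+ 4) (λ j → inc j p * 𝟙 (sel j))))
                     (sym (*-distribˡ-sum (- + 2) (λ j → inc j p))) ⟩
      + 4 * ∑[ j < b ] (inc j p * 𝟙 (sel j)) + - + 2 * replication p
        ≡⟨ cong₂ (λ a r → + 4 * a + - + 2 * r) ∑sel≡t (trans (replication≡ρ p) (cong +_ ρ≡2t)) ⟩
      + 4 * + t + - + 2 * + (t ℕ.* 2)
        ≡⟨ cong (λ r → + 4 * + t + - + 2 * r) (ℤP.pos-* t 2) ⟩
      + 4 * + t + - + 2 * (+ t * + 2)
        ≡⟨ balance (+ t) ⟩
      + 0 ∎
      where
      expand : ∀ m s → m * (+ 2 * (s * + 2 - + 1)) ≡ + 4 * (m * s) + - + 2 * m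
      expand = solve-∀
      balance : ∀ t → + 4 * t + - + 2 * (t * + 2) ≡ + 0
      balance = solve-∀

    entry : ∀ j → NonzeroAtMost 3 (blockSum star j)
    entry j = by-membership (p ∈? B j)
      where
      twice-sign : ∀ {s} → Sign s → NonzeroAtMost 3 (+ 0 + + 2 * s)
      twice-sign (inj₁ refl) = (λ ()) , ℕ.s≤s (ℕ.s≤s ℕ.z≤n)
      twice-sign (inj₂ refl) = (λ ()) , ℕ.s≤s (ℕ.s≤s ℕ.z≤n)
      by-membership : Dec (p ∈ B j) → NonzeroAtMost 3 (blockSum star j)
      by-membership (yes p∈j) =
        subst (NonzeroAtMost 3) (sym (trans (blockSum-star-through p∈j) (cong (λ a → + 0 + a) (arm-through p∈j))))
              (twice-sign (sign-± j))
      by-membership (no p∉j) = blockSum-star-away p∉j (λ k _ → sign-± k)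

  m1≤5 : ∀ {p q} → p ≢ q → 3 ℕ.< n → m1Le B 5
  m1≤5 {p} p≢q 3<n with two-blocks-through p≢q 3<n
  ... | J₁ , J₂ , J₁≢J₂ , p∈J₁ , p∈J₂ =
    m1Le-intro B (blockSum star) 4 J₁ (blockSum-eigen star ∑-star≡0) entry
    where
    keep : Fin b → ℤ
    keep j = + 1 - ⟦ J₁ ≟ j ⟧ - ⟦ J₂ ≟ j ⟧

    label : Fin b → Fin n → ℤ
    label j y = - + 1 + + 2 * (keep j * ⟦ partner p j ≟ y ⟧)

    open Star p (+ 4) label

    keep-01 : ∀ j → keep j ≡ + 1 ⊎ keep j ≡ + 0
    keep-01 j with J₁ ≟ j | J₂ ≟ j
    ... | yes J₁≡j | yes J₂≡j = ⊥-elim (J₁≢J₂ (trans J₁≡j (sym J₂≡j)))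
    ... | yes _    | no _     = inj₂ refl
    ... | no _     | yes _    = inj₂ refl
    ... | no _     | no _     = inj₁ refl

    label-± : ∀ j y → Sign (label j y)
    label-± j y with partner p j ≟ y
    ... | no _ = inj₂ (cong (λ z → - + 1 + + 2 * z) (ℤP.*-zeroʳ (keep j)))
    ... | yes _ with keep-01 j
    ...   | inj₁ keep≡1 = inj₁ (cong (λ k → - + 1 + + 2 * (k * + 1)) keep≡1)
    ...   | inj₂ keep≡0 = inj₂ (cong (λ k → - + 1 + + 2 * (k * + 1)) keep≡0)

    arm-through : ∀ {j} → p ∈ B j → arm j ≡ - + 2 + + 2 * keep j
    arm-through {j} p∈j = begin
      ∑[ y < n ] (δ̄ y * (inc j y * label j y))
        ≡⟨ sum-cong-≗ (λ y → expand (δ̄ y) (inc j y) (keep j) ⟦ d ≟ y ⟧) ⟩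
      ∑[ y < n ] (- + 1 * (δ̄ y * inc j y) + + 2 * keep j * (⟦ d ≟ y ⟧ * (δ̄ y * inc j y)))
        ≡⟨ ∑-distrib-+ (λ y → - + 1 * (δ̄ y * inc j y)) (λ y → + 2 * keep j * (⟦ d ≟ y ⟧ * (δ̄ y * inc j y))) ⟩
      ∑[ y < n ] (- + 1 * (δ̄ y * inc j y)) + ∑[ y < n ] (+ 2 * keep j * (⟦ d ≟ y ⟧ * (δ̄ y * inc j y)))
        ≡⟨ cong₂ _+_ (sym (*-distribˡ-sum (- + 1) (λ y → δ̄ y * inc j y)))
                     (sym (*-distribˡ-sum (+ 2 * keep j) (λ y → ⟦ d ≟ y ⟧ * (δ̄ y * inc j y)))) ⟩
      - + 1 * ∑[ y < n ] (δ̄ y * inc j y) + + 2 * keep j * ∑[ y < n ] (⟦ d ≟ y ⟧ * (δ̄ y * inc j y))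
        ≡⟨ cong₂ (λ o e → - + 1 * o + + 2 * keep j * e) (∑-others-in-block p∈j) (∑-δ d (λ y → δ̄ y * inc j y)) ⟩
      - + 1 * + 2 + + 2 * keep j * (δ̄ d * inc j d)
        ≡⟨ cong₂ (λ u v → - + 1 * + 2 + + 2 * keep j * (u * v))
                 (⟦⟧-yes (¬? (p ≟ d)) (proj₁ (partner-∈ p∈j))) (inc-∈ (proj₂ (partner-∈ p∈j))) ⟩
      - + 1 * + 2 + + 2 * keep j * (+ 1 * + 1)
        ≡⟨ tidy (keep j) ⟩
      - + 2 + + 2 * keep j ∎
      where
      d : Fin n
      d = partner p j
      δ̄ : Fin n → ℤ
      δ̄ y = ⟦ ¬? (p ≟ y) ⟧
      expand : ∀ e m k δ → e * (m * (- + 1 + + 2 * (k * δ))) ≡ - + 1 * (e * m) + + 2 * k * (δ * (e * m))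
      expand = solve-∀
      tidy : ∀ k → - + 1 * + 2 + + 2 * k * (+ 1 * + 1) ≡ - + 2 + + 2 * k
      tidy = solve-∀

    ∑-star≡0 : ∑[ y < n ] star y ≡ + 0
    ∑-star≡0 = begin
      ∑[ y < n ] star y
        ≡⟨ ∑-star ⟩
      + 4 + ∑[ j < b ] (inc j p * arm j)
        ≡⟨ cong (λ s → + 4 + s) (sum-cong-≗ (λ j → trans (inc-*-cong arm-through)
                                              (expand (inc j p) ⟦ J₁ ≟ j ⟧ ⟦ J₂ ≟ j ⟧))) ⟩
      + 4 + ∑[ j < b ] (- + 2 * (⟦ J₁ ≟ j ⟧ * inc j p) + - + 2 * (⟦ J₂ ≟ j ⟧ * inc j p))
        ≡⟨ cong (λ s → + 4 + s) (∑-distrib-+ (λ j → - + 2 * (⟦ J₁ ≟ j ⟧ * inc j p))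
                                             (λ j → - + 2 * (⟦ J₂ ≟ j ⟧ * inc j p))) ⟩
      + 4 + (∑[ j < b ] (- + 2 * (⟦ J₁ ≟ j ⟧ * inc j p)) + ∑[ j < b ] (- + 2 * (⟦ J₂ ≟ j ⟧ * inc j p)))
        ≡⟨ cong₂ (λ u v → + 4 + (u + v)) (single p∈J₁) (single p∈J₂) ⟩
      + 0 ∎
      where
      single : ∀ {J} → p ∈ B J → ∑[ j < b ] (- + 2 * (⟦ J ≟ j ⟧ * inc j p)) ≡ - + 2
      single {J} p∈J = begin
        ∑[ j < b ] (- + 2 * (⟦ J ≟ j ⟧ * inc j p))  ≡⟨ sym (*-distribˡ-sum (- + 2) (λ j → ⟦ J ≟ j ⟧ * inc j p)) ⟩
        - + 2 * ∑[ j < b ] (⟦ J ≟ j ⟧ * inc j p)    ≡⟨ cong (- + 2 *_) (trans (∑-δ J (λ j → inc j p)) (inc-∈ p∈J)) ⟩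
        - + 2 * + 1                                 ∎
      expand : ∀ m a c → m * (- + 2 + + 2 * (+ 1 - a - c)) ≡ - + 2 * (a * m) + - + 2 * (c * m)
      expand = solve-∀

    entry : ∀ j → NonzeroAtMost 4 (blockSum star j)
    entry j = by-membership (p ∈? B j)
      where
      four-plus-arm : ∀ {k} → k ≡ + 1 ⊎ k ≡ + 0 → NonzeroAtMost 4 (+ 4 + (- + 2 + + 2 * k))
      four-plus-arm (inj₁ refl) = (λ ()) , ℕP.≤-refl
      four-plus-arm (inj₂ refl) = (λ ()) , ℕ.s≤s (ℕ.s≤s ℕ.z≤n)
      by-membership : Dec (p ∈ B j) → NonzeroAtMost 4 (blockSum star j)
      by-membership (yes p∈j) =
        subst (NonzeroAtMost 4) (sym (trans (blockSum-star-through p∈j) (cong (λ a → + 4 + a) (arm-through p∈j))))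
              (four-plus-arm (keep-01 j))
      by-membership (no p∉j) =
        let nonzero , ≤3 = blockSum-star-away p∉j label-± in nonzero , ℕP.m≤n⇒m≤1+n ≤3

[n∸1]/2≡[n/4]*2 : ∀ n → n % 4 ≡ 1 → (n ∸ 1) / 2 ≡ (n / 4) ℕ.* 2
[n∸1]/2≡[n/4]*2 n n%4≡1 = begin
  (n ∸ 1) / 2                             ≡⟨ cong (λ m → (m ∸ 1) / 2) (ℕ.m≡m%n+[m/n]*n n 4) ⟩
  (n % 4 ℕ.+ n / 4 ℕ.* 4 ∸ 1) / 2         ≡⟨ cong (λ r → (r ℕ.+ n / 4 ℕ.* 4 ∸ 1) / 2) n%4≡1 ⟩
  (n / 4 ℕ.* 4) / 2                       ≡⟨ cong (_/ 2) (sym (ℕP.*-assoc (n / 4) 2 2)) ⟩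
  (n / 4 ℕ.* 2 ℕ.* 2) / 2                 ≡⟨ ℕ.m*n/n≡m (n / 4 ℕ.* 2) 2 ⟩
  n / 4 ℕ.* 2                             ∎

theorem6 : (n b : ℕ) (B : Fin b → Subset n) → IsSTS n b B → n > 7 →
    ((n % 4 ≡ 1 → m1Le B 4) × (n % 4 ≡ 3 → m1Le B 5))
theorem6 zero b B S ()
theorem6 (suc zero) b B S (ℕ.s≤s ())
theorem6 (suc (suc k)) b B S n>7 =
  (λ n%4≡1 → m1≤4-of-even-replication 0≢1 (n / 4) ([n∸1]/2≡[n/4]*2 n n%4≡1)) ,
  (λ _ → m1≤5 0≢1 (ℕP.≤-trans (ℕP.m≤m+n 4 4) n>7))
  where
  open BlockGraph S
  n : ℕ
  n = suc (suc k)
  0≢1 : zero ≢ suc zero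
  0≢1 ()
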